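{- For every integer $n\ge 0$, \[ \sum_{k=-\infty}^{\infty}(-1)^k\,p_{do}\bigl(n-k(3k+1)\bigr)=\begin{cases}(-1)^{\lceil m/2\rceil}, & \text{if } n=\frac{m(3m+1)}{2} \text{ for some } m\in\mathbb{Z},\\ 0, & \text{otherwise}.\end{cases} \]
   Context: $p_{do}(n)$ is the number of partitions of $n$ into distinct odd parts, $\sum_{n\ge0}p_{do}(n)q^n=\prod_{k\ge1}(1+q^{2k-1})$, with the convention $p_{do}(x)=0$ whenever $x$ is not a nonnegative integer. -}

module Defs where

open import Data.Nat as ℕ using (ℕ; zero; suc; ⌊_/2⌋)
open import Data.Integer as ℤ using (ℤ; +_; -[1+_]; _+_; _-_; _*_; -_; 1ℤ; 0ℤ; ∣_∣)
open import Data.List using (List; []; _∷_; length; filter; map; _++_)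
open import Data.Nat.ListAction using (sum)
open import Relation.Binary.PropositionalEquality using (_≡_)
import Data.Nat.Properties as ℕP
open import Data.Parity.Base using (0ℙ; 1ℙ)

-- All sets of distinct odd parts drawn from {1,3,...,2j-1},
-- each represented as a strictly decreasing list.
oddSubsets : ℕ → List (List ℕ)
oddSubsets zero    = [] ∷ []
oddSubsets (suc j) = oddSubsets j ++ map ((2 ℕ.* j ℕ.+ 1) ∷_) (oddSubsets j)

-- p_do(n): number of partitions of n into distinct odd parts.
-- Every part of such a partition is ≤ n ≤ 2n-1, so the subsets of
-- {1,3,...,2n-1} with sum n are exactly these partitions.
pdo : ℕ → ℕ
pdo n = length (filter (λ xs → sum xs ℕP.≟ n) (oddSubsets n))

pdoℤ : ℤ → ℕ
pdoℤ (+ n)    = pdo n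
pdoℤ -[1+ n ] = 0

signPow : ℤ → ℤ
signPow z with ℕ.parity ∣ z ∣
... | 0ℙ = 1ℤ
... | 1ℙ = - 1ℤ

ceilHalf : ℤ → ℤ
ceilHalf (+ n)    = + ⌊ suc n /2⌋
ceilHalf -[1+ n ] = - (+ ⌊ suc n /2⌋)

symSum : (ℤ → ℤ) → ℕ → ℤ
symSum f zero    = f 0ℤ
symSum f (suc N) = symSum f N + f (+ suc N) + f -[1+ N ]

term : ℕ → ℤ → ℤ
term n k = signPow k * + pdoℤ (+ n - k * (+ 3 * k + 1ℤ))

-- The sum is the coefficient of qⁿ in F(q²) G(q), where F(q) = Σₖ (−1)ᵏ q^{k(3k+1)/2} and
-- G(q) = ∏_{i≥1} (1 + q^{2i−1}) generates p_do. Euler's pentagonal theorem gives F(q²) = (q²;q²)_∞,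
-- and (q²;q²)_∞ (−q;q²)_∞ = (−q;−q)_∞ = F(−q), so the coefficient is (−1)ⁿ times that of qⁿ in F(q):
-- (−1)ᵐ if n = m(3m+1)/2, else 0; and n + m ≡ ⌈m/2⌉ mod 2. Only finite products are needed: by
-- Shanks' finite form of the pentagonal theorem, the partial sum Σ_{|k|≤N} of F agrees with (q;q)_N
-- below degree N + 1.

module Submission where

open import Data.Bool using (true; false)
open import Data.Empty using (⊥-elim)
open import Data.Integer using (ℤ; +_; -[1+_]; ∣_∣)
import Data.Integer.Properties as ℤₚ
open import Data.List using (List; []; _∷_; _++_; length; map; filter)
open import Data.List.Properties using (filter-++; filter-≐; filter-none; length-++; length-map)
import Data.List.Relation.Unary.All as All
open import Data.Nat as ℕ using (ℕ; zero; suc; _≤_; _<_; z≤n; s≤s; _≤?_; ⌊_/2⌋)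
open import Data.Nat.ListAction using (sum)
import Data.Nat.Properties as ℕₚ
import Data.Nat.Tactic.RingSolver as ℕSolver
open import Data.Product using (Σ; _×_; _,_)
open import Data.Sum using (inj₁; inj₂)
open import Function using (_∘_; _⇔_; mk⇔; Equivalence)
open import Relation.Binary.PropositionalEquality
open import Relation.Nullary using (yes; no; ¬_; does)
open import Relation.Unary using (Decidable)

open import Defs

module Pentagonal where

  open import Data.Nat
  open import Data.Nat.Properties
  open import Data.Nat.Tactic.RingSolver using (solve-∀)
  open ≡-Reasoning

  triangular : ℕ → ℕ
  triangular zero    = 0
  triangular (suc k) = triangular k + suc k

  pentagonal : ℕ → ℕ
  pentagonal zero    = 0
  pentagonal (suc a) = pentagonal a + (3 * a + 1)

  -- k(3k + 1)/2: pentagonal a = a(3a − 1)/2 is the value at k = −a.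
  gpent : ℤ → ℕ
  gpent (+ a)    = pentagonal a + a
  gpent -[1+ a ] = pentagonal (suc a)

  pentagonal+id≡square+triangular : ∀ a → pentagonal a + a ≡ a * a + triangular a
  pentagonal+id≡square+triangular zero    = refl
  pentagonal+id≡square+triangular (suc a) = begin
    pentagonal a + (3 * a + 1) + suc a     ≡⟨ regroup (pentagonal a) a ⟩
    (pentagonal a + a) + (3 * a + 2)        ≡⟨ cong (_+ (3 * a + 2)) (pentagonal+id≡square+triangular a) ⟩
    a * a + triangular a + (3 * a + 2)      ≡⟨ complete a (triangular a) ⟩
    suc a * suc a + (triangular a + suc a)  ∎
    where
    regroup : ∀ p a → p + (3 * a + 1) + suc a ≡ (p + a) + (3 * a + 2)
    regroup = solve-∀
    complete : ∀ a t → a * a + t + (3 * a + 2) ≡ suc a * suc a + (t + suc a)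
    complete = solve-∀

  pentagonal-suc-as-triangular : ∀ n → pentagonal (suc n) ≡ n * suc n + triangular n + suc n
  pentagonal-suc-as-triangular n = +-cancelʳ-≡ (suc n) _ _ (begin
    pentagonal (suc n) + suc n                    ≡⟨ pentagonal+id≡square+triangular (suc n) ⟩
    suc n * suc n + (triangular n + suc n)        ≡⟨ regroup n (triangular n) ⟩
    n * suc n + triangular n + suc n + suc n      ∎)
    where
    regroup : ∀ n t → suc n * suc n + (t + suc n) ≡ n * suc n + t + suc n + suc n
    regroup = solve-∀

  gpent-pos-double : ∀ a → a * (3 * a + 1) ≡ gpent (+ a) * 2
  gpent-pos-double zero    = refl
  gpent-pos-double (suc a) = begin
    suc a * (3 * suc a + 1)                   ≡⟨ expand a ⟩
    a * (3 * a + 1) + (6 * a + 4)             ≡⟨ cong (_+ (6 * a + 4)) (gpent-pos-double a) ⟩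
    (pentagonal a + a) * 2 + (6 * a + 4)      ≡⟨ regroup (pentagonal a) a ⟩
    (pentagonal a + (3 * a + 1) + suc a) * 2  ∎
    where
    expand : ∀ a → suc a * (3 * suc a + 1) ≡ a * (3 * a + 1) + (6 * a + 4)
    expand = solve-∀
    regroup : ∀ p a → (p + a) * 2 + (6 * a + 4) ≡ (p + (3 * a + 1) + suc a) * 2
    regroup = solve-∀

  gpent-neg-double : ∀ a → suc a * (3 * a + 2) ≡ gpent -[1+ a ] * 2
  gpent-neg-double a = begin
    suc a * (3 * a + 2)                   ≡⟨ expand a ⟩
    a * (3 * a + 1) + (2 * a + 1) * 2     ≡⟨ cong (_+ (2 * a + 1) * 2) (gpent-pos-double a) ⟩
    (pentagonal a + a) * 2 + (2 * a + 1) * 2 ≡⟨ regroup (pentagonal a) a ⟩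
    (pentagonal a + (3 * a + 1)) * 2      ∎
    where
    expand : ∀ a → suc a * (3 * a + 2) ≡ a * (3 * a + 1) + (2 * a + 1) * 2
    expand = solve-∀
    regroup : ∀ p a → (p + a) * 2 + (2 * a + 1) * 2 ≡ (p + (3 * a + 1)) * 2
    regroup = solve-∀

  pentagonal-mono-≤ : ∀ {a b} → a ≤ b → pentagonal a ≤ pentagonal b
  pentagonal-mono-≤ z≤n = z≤n
  pentagonal-mono-≤ (s≤s a≤b) = +-mono-≤ (pentagonal-mono-≤ a≤b) (+-monoˡ-≤ 1 (*-monoʳ-≤ 3 a≤b))

  n<3n+1 : ∀ n → n < 3 * n + 1
  n<3n+1 n = ≤-<-trans (m≤n*m n 3) (m<m+n (3 * n) z<s)

  gpent-pos<pentagonal-suc : ∀ a → gpent (+ a) < pentagonal (suc a)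
  gpent-pos<pentagonal-suc a = +-monoʳ-< (pentagonal a) (n<3n+1 a)

  pentagonal<pentagonal-suc : ∀ a → pentagonal a < pentagonal (suc a)
  pentagonal<pentagonal-suc a = ≤-<-trans (m≤m+n (pentagonal a) a) (gpent-pos<pentagonal-suc a)

  ∣k∣≤gpent : ∀ k → ∣ k ∣ ≤ gpent k
  ∣k∣≤gpent (+ a)    = m≤n+m a (pentagonal a)
  ∣k∣≤gpent -[1+ a ] = ≤-trans (n<3n+1 a) (m≤n+m (3 * a + 1) (pentagonal a))

open Pentagonal

open import Data.Integer using (_+_; _-_; _*_; -_; _^_; 0ℤ; 1ℤ; -1ℤ)
open import Data.Integer.Tactic.RingSolver using (solve-∀)

-1^[2+k]≡-1^k : ∀ k → -1ℤ ^ suc (suc k) ≡ -1ℤ ^ k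
-1^[2+k]≡-1^k k = cancel (-1ℤ ^ k)
  where
  cancel : ∀ u → -1ℤ * (-1ℤ * u) ≡ u
  cancel = solve-∀

-1^[k*2]≡1 : ∀ k → -1ℤ ^ (k ℕ.* 2) ≡ 1ℤ
-1^[k*2]≡1 zero    = refl
-1^[k*2]≡1 (suc k) = trans (-1^[2+k]≡-1^k (k ℕ.* 2)) (-1^[k*2]≡1 k)

-1^[p+k*2]≡-1^p : ∀ p k → -1ℤ ^ (p ℕ.+ k ℕ.* 2) ≡ -1ℤ ^ p
-1^[p+k*2]≡-1^p p k = begin
  -1ℤ ^ (p ℕ.+ k ℕ.* 2)          ≡⟨ ℤₚ.^-distribˡ-+-* -1ℤ p (k ℕ.* 2) ⟩
  -1ℤ ^ p * -1ℤ ^ (k ℕ.* 2)      ≡⟨ cong (-1ℤ ^ p *_) (-1^[k*2]≡1 k) ⟩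
  -1ℤ ^ p * 1ℤ                   ≡⟨ ℤₚ.*-identityʳ (-1ℤ ^ p) ⟩
  -1ℤ ^ p                        ∎
  where open ≡-Reasoning

signPow-pos : ∀ k → signPow (+ k) ≡ -1ℤ ^ k
signPow-pos zero          = refl
signPow-pos (suc zero)    = refl
signPow-pos (suc (suc k)) = trans (signPow-pos k) (sym (-1^[2+k]≡-1^k k))

signPow≡-1^∣z∣ : ∀ z → signPow z ≡ -1ℤ ^ ∣ z ∣
signPow≡-1^∣z∣ (+ k)    = signPow-pos k
signPow≡-1^∣z∣ -[1+ k ] = signPow-pos (suc k)

-- A formal power series Σ f x qˣ is its coefficient function f; shift a multiplies by qᵃ,
-- factor c a by 1 + c qᵃ.
Series : Set
Series = ℕ → ℤ

infix 4 _≈_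

_≈_ : Series → Series → Set
f ≈ g = ∀ x → f x ≡ g x

shift : ℕ → Series → Series
shift zero    f         = f
shift (suc a) f zero    = 0ℤ
shift (suc a) f (suc x) = shift a f x

factor : ℤ → ℕ → Series → Series
factor c a f x = f x + c * shift a f x

one : Series
one zero    = 1ℤ
one (suc x) = 0ℤ

shift-below : ∀ a f {x} → x < a → shift a f x ≡ 0ℤ
shift-below (suc a) f {zero}  _         = refl
shift-below (suc a) f {suc x} (s≤s x<a) = shift-below a f x<a

shift-+ : ∀ a f x → shift a f (a ℕ.+ x) ≡ f x
shift-+ zero    f x = refl
shift-+ (suc a) f x = shift-+ a f x

shift-one-≢ : ∀ a {x} → x ≢ a → shift a one x ≡ 0ℤ
shift-one-≢ zero    {zero}  x≢a = ⊥-elim (x≢a refl)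
shift-one-≢ zero    {suc x} x≢a = refl
shift-one-≢ (suc a) {zero}  x≢a = refl
shift-one-≢ (suc a) {suc x} x≢a = shift-one-≢ a (x≢a ∘ cong suc)

shift-one-≡ : ∀ a → shift a one a ≡ 1ℤ
shift-one-≡ zero    = refl
shift-one-≡ (suc a) = shift-one-≡ a

shift-factor : ∀ e c a f x → shift e (factor c a f) x ≡ shift e f x + c * shift (e ℕ.+ a) f x
shift-factor zero    c a f x       = refl
shift-factor (suc e) c a f zero    = sym (trans (ℤₚ.+-identityˡ (c * 0ℤ)) (ℤₚ.*-zeroʳ c))
shift-factor (suc e) c a f (suc x) = shift-factor e c a f x

factor-below : ∀ c a f {x} → x < a → factor c a f x ≡ f x
factor-below c a f {x} x<a = begin
  f x + c * shift a f x ≡⟨ cong (λ v → f x + c * v) (shift-below a f x<a) ⟩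
  f x + c * 0ℤ          ≡⟨ cong (λ v → f x + v) (ℤₚ.*-zeroʳ c) ⟩
  f x + 0ℤ              ≡⟨ ℤₚ.+-identityʳ (f x) ⟩
  f x                   ∎
  where open ≡-Reasoning

shift-cong : ∀ a {f g} → f ≈ g → shift a f ≈ shift a g
shift-cong zero    f≈g x       = f≈g x
shift-cong (suc a) f≈g zero    = refl
shift-cong (suc a) f≈g (suc x) = shift-cong a f≈g x

factor-cong : ∀ c a {f g} → f ≈ g → factor c a f ≈ factor c a g
factor-cong c a f≈g x = cong₂ (λ u v → u + c * v) (f≈g x) (shift-cong a f≈g x)

factor-≡ : ∀ c {a a′} f → a ≡ a′ → factor c a f ≈ factor c a′ f
factor-≡ c f refl x = refl

factor-comm : ∀ c a d b f → factor c a (factor d b f) ≈ factor d b (factor c a f)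
factor-comm c a d b f x = begin
  (f x + d * shift b f x) + c * shift a (factor d b f) x
    ≡⟨ cong (λ v → (f x + d * shift b f x) + c * v) (shift-factor a d b f x) ⟩
  (f x + d * shift b f x) + c * (shift a f x + d * shift (a ℕ.+ b) f x)
    ≡⟨ cong (λ e → (f x + d * shift b f x) + c * (shift a f x + d * shift e f x)) (ℕₚ.+-comm a b) ⟩
  (f x + d * shift b f x) + c * (shift a f x + d * shift (b ℕ.+ a) f x)
    ≡⟨ swap (f x) c d (shift a f x) (shift b f x) (shift (b ℕ.+ a) f x) ⟩
  (f x + c * shift a f x) + d * (shift b f x + c * shift (b ℕ.+ a) f x)
    ≡⟨ cong (λ v → (f x + c * shift a f x) + d * v) (sym (shift-factor b c a f x)) ⟩
  (f x + c * shift a f x) + d * shift b (factor c a f) x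
    ∎
  where
  open ≡-Reasoning
  swap : ∀ y c d u v w → (y + d * v) + c * (u + d * w) ≡ (y + c * u) + d * (v + c * w)
  swap = solve-∀

-- substitution q ↦ −q
twist : Series → Series
twist f x = -1ℤ ^ x * f x

shift-twist : ∀ a h x → shift a (twist h) x ≡ -1ℤ ^ a * twist (shift a h) x
shift-twist zero    h x       = sym (ℤₚ.*-identityˡ (twist h x))
shift-twist (suc a) h zero    = sym (ℤₚ.*-zeroʳ (-1ℤ ^ suc a))
shift-twist (suc a) h (suc x) =
  trans (shift-twist a h x) (regroup (-1ℤ ^ a) (-1ℤ ^ x) (shift a h x))
  where
  regroup : ∀ u v w → u * (v * w) ≡ (-1ℤ * u) * ((-1ℤ * v) * w)
  regroup = solve-∀

factor-twist : ∀ {c c′} a h → c′ ≡ -1ℤ ^ a * c → factor c a (twist h) ≈ twist (factor c′ a h)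
factor-twist {c} a h refl x = begin
  twist h x + c * shift a (twist h) x
    ≡⟨ cong (λ v → twist h x + c * v) (shift-twist a h x) ⟩
  -1ℤ ^ x * h x + c * (-1ℤ ^ a * (-1ℤ ^ x * shift a h x))
    ≡⟨ regroup (-1ℤ ^ x) (-1ℤ ^ a) c (h x) (shift a h x) ⟩
  -1ℤ ^ x * (h x + -1ℤ ^ a * c * shift a h x)
    ∎
  where
  open ≡-Reasoning
  regroup : ∀ s t c y z → s * y + c * (t * (s * z)) ≡ s * (y + t * c * z)
  regroup = solve-∀

sumUpTo : (ℕ → ℤ) → ℕ → ℤ
sumUpTo F zero    = F zero
sumUpTo F (suc m) = sumUpTo F m + F (suc m)

module Shanks (s : ℕ) where

  -- multiplication by ∏_{i = k+1}^{n} (1 − q^{i s})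
  poch : ℕ → ℕ → Series → Series
  poch k zero    f = f
  poch k (suc n) f with k ≤? n
  ... | yes _ = factor -1ℤ (suc n ℕ.* s) (poch k n f)
  ... | no  _ = f

  poch-suc : ∀ {k} n f → k ≤ n → poch k (suc n) f ≡ factor -1ℤ (suc n ℕ.* s) (poch k n f)
  poch-suc {k} n f k≤n with k ≤? n
  ... | yes _   = refl
  ... | no  k≰n = ⊥-elim (k≰n k≤n)

  poch-empty : ∀ {k n} f → n ≤ k → poch k n f ≡ f
  poch-empty {k} {zero}  f _   = refl
  poch-empty {k} {suc n} f n<k with k ≤? n
  ... | yes k≤n = ⊥-elim (ℕₚ.<⇒≱ n<k k≤n)
  ... | no  _   = refl

  poch-cong : ∀ k n {f g} → f ≈ g → poch k n f ≈ poch k n g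
  poch-cong k zero    f≈g = f≈g
  poch-cong k (suc n) f≈g with k ≤? n
  ... | yes _ = factor-cong -1ℤ (suc n ℕ.* s) (poch-cong k n f≈g)
  ... | no  _ = f≈g

  factor-poch : ∀ c a k n f → factor c a (poch k n f) ≈ poch k n (factor c a f)
  factor-poch c a k zero    f x = refl
  factor-poch c a k (suc n) f with k ≤? n
  ... | yes _ = λ x → trans (factor-comm c a -1ℤ (suc n ℕ.* s) (poch k n f) x)
                            (factor-cong -1ℤ (suc n ℕ.* s) (factor-poch c a k n f) x)
  ... | no  _ = λ x → refl

  poch-lowest : ∀ {k n} f → k < n → poch k n f ≈ factor -1ℤ (suc k ℕ.* s) (poch (suc k) n f)
  poch-lowest {k} {suc n} f (s≤s k≤n) with ℕₚ.m≤n⇒m<n∨m≡n k≤n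
  ... | inj₂ refl
    rewrite poch-suc k f (ℕₚ.≤-refl {k}) | poch-empty {k} f ℕₚ.≤-refl | poch-empty {suc k} f ℕₚ.≤-refl
    = λ x → refl
  ... | inj₁ k<n = λ x → begin
    poch k (suc n) f x
      ≡⟨ cong (λ h → h x) (poch-suc n f k≤n) ⟩
    factor -1ℤ top (poch k n f) x
      ≡⟨ factor-cong -1ℤ top (poch-lowest f k<n) x ⟩
    factor -1ℤ top (factor -1ℤ bot (poch (suc k) n f)) x
      ≡⟨ factor-comm -1ℤ top -1ℤ bot (poch (suc k) n f) x ⟩
    factor -1ℤ bot (factor -1ℤ top (poch (suc k) n f)) x
      ≡⟨ cong (λ h → factor -1ℤ bot h x) (poch-suc n f k<n) ⟨
    factor -1ℤ bot (poch (suc k) (suc n) f) x ∎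
    where
    open ≡-Reasoning
    top = suc n ℕ.* s
    bot = suc k ℕ.* s

  poch-stable : ∀ {m n} f {x} → m ≤ n → x < suc m ℕ.* s → poch 0 n f x ≡ poch 0 m f x
  poch-stable {m} {zero}  f z≤n      x<ms = refl
  poch-stable {m} {suc n} f {x} m≤1+n x<ms with ℕₚ.m≤n⇒m<n∨m≡n m≤1+n
  ... | inj₂ refl     = refl
  ... | inj₁ (s≤s m≤n) = begin
    poch 0 (suc n) f x
      ≡⟨ cong (λ h → h x) (poch-suc n f z≤n) ⟩
    factor -1ℤ (suc n ℕ.* s) (poch 0 n f) x
      ≡⟨ factor-below -1ℤ (suc n ℕ.* s) (poch 0 n f) (ℕₚ.<-≤-trans x<ms (ℕₚ.*-monoˡ-≤ s (s≤s m≤n))) ⟩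
    poch 0 n f x
      ≡⟨ poch-stable f m≤n x<ms ⟩
    poch 0 m f x ∎
    where open ≡-Reasoning

  -- Every series below is a multiple of b, so that no product of series is ever formed.
  module _ (b : Series) where

    shanksTerm : ℕ → ℕ → Series
    shanksTerm n k x = -1ℤ ^ k * shift ((k ℕ.* n ℕ.+ triangular k) ℕ.* s) (poch k n b) x

    shanksSum : ℕ → Series
    shanksSum n x = sumUpTo (λ k → shanksTerm n k x) n

    pentagonalSum : ℕ → Series
    pentagonalSum zero      = b
    pentagonalSum (suc j) x = pentagonalSum j x
      + -1ℤ ^ suc j * (shift (gpent (+ suc j) ℕ.* s) b x + shift (gpent -[1+ j ] ℕ.* s) b x)

    -- Expanding the top factor of poch k (n + 1) splits shanksTerm (n + 1) k into two parts; the
    -- second (carry n k) cancels against part of shanksTerm (n + 1) (k + 1), by poch-lowest.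
    private
      carry : ℕ → ℕ → Series
      carry n k x = -1ℤ ^ k * shift ((k ℕ.* suc n ℕ.+ triangular k ℕ.+ suc n) ℕ.* s) (poch k n b) x

      shanksTerm-expand : ∀ {k} n x → k ≤ n →
        shanksTerm (suc n) k x ≡ -1ℤ ^ k * shift ((k ℕ.* suc n ℕ.+ triangular k) ℕ.* s) (poch k n b) x - carry n k x
      shanksTerm-expand {k} n x k≤n = begin
        -1ℤ ^ k * shift E (poch k (suc n) b) x
          ≡⟨ cong (λ h → -1ℤ ^ k * shift E h x) (poch-suc n b k≤n) ⟩
        -1ℤ ^ k * shift E (factor -1ℤ (suc n ℕ.* s) X) x
          ≡⟨ cong (-1ℤ ^ k *_) (shift-factor E -1ℤ (suc n ℕ.* s) X x) ⟩
        -1ℤ ^ k * (shift E X x + -1ℤ * shift (E ℕ.+ suc n ℕ.* s) X x)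
          ≡⟨ cong (λ e → -1ℤ ^ k * (shift E X x + -1ℤ * shift e X x))
                  (ℕₚ.*-distribʳ-+ s (k ℕ.* suc n ℕ.+ triangular k) (suc n)) ⟨
        -1ℤ ^ k * (shift E X x + -1ℤ * shift E′ X x)
          ≡⟨ distrib (-1ℤ ^ k) (shift E X x) (shift E′ X x) ⟩
        -1ℤ ^ k * shift E X x - -1ℤ ^ k * shift E′ X x
          ∎
        where
        open ≡-Reasoning
        E  = (k ℕ.* suc n ℕ.+ triangular k) ℕ.* s
        E′ = (k ℕ.* suc n ℕ.+ triangular k ℕ.+ suc n) ℕ.* s
        X  = poch k n b
        distrib : ∀ a u v → a * (u + -1ℤ * v) ≡ a * u - a * v
        distrib = solve-∀

      shanksTerm-suc : ∀ {j} n x → suc j ≤ n →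
        shanksTerm (suc n) (suc j) x ≡ (shanksTerm n (suc j) x + carry n j x) - carry n (suc j) x
      shanksTerm-suc {j} n x j<n =
        trans (shanksTerm-expand n x j<n) (cong (_- carry n (suc j) x) (begin
        -1ℤ ^ suc j * shift E Y x
          ≡⟨ cong (λ e → -1ℤ ^ suc j * shift e Y x) E≡F+ ⟩
        -1ℤ ^ suc j * shift (F ℕ.+ suc j ℕ.* s) Y x
          ≡⟨ telescope (-1ℤ ^ j) (shift F Y x) (shift (F ℕ.+ suc j ℕ.* s) Y x) ⟩
        -1ℤ ^ suc j * shift F Y x + -1ℤ ^ j * (shift F Y x + -1ℤ * shift (F ℕ.+ suc j ℕ.* s) Y x)
          ≡⟨ cong (λ v → shanksTerm n (suc j) x + -1ℤ ^ j * v) (shift-factor F -1ℤ (suc j ℕ.* s) Y x) ⟨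
        shanksTerm n (suc j) x + -1ℤ ^ j * shift F (factor -1ℤ (suc j ℕ.* s) Y) x
          ≡⟨ cong (λ v → shanksTerm n (suc j) x + -1ℤ ^ j * v) (shift-cong F (poch-lowest b j<n) x) ⟨
        shanksTerm n (suc j) x + -1ℤ ^ j * shift F (poch j n b) x
          ≡⟨ cong (λ e → shanksTerm n (suc j) x + -1ℤ ^ j * shift e (poch j n b) x) G≡F ⟨
        shanksTerm n (suc j) x + carry n j x
          ∎))
        where
        open ≡-Reasoning
        E = (suc j ℕ.* suc n ℕ.+ triangular (suc j)) ℕ.* s
        F = (suc j ℕ.* n ℕ.+ triangular (suc j)) ℕ.* s
        Y = poch (suc j) n b
        top : ∀ j n t → suc j ℕ.* suc n ℕ.+ (t ℕ.+ suc j) ≡ suc j ℕ.* n ℕ.+ (t ℕ.+ suc j) ℕ.+ suc j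
        top = ℕSolver.solve-∀
        low : ∀ j n t → j ℕ.* suc n ℕ.+ t ℕ.+ suc n ≡ suc j ℕ.* n ℕ.+ (t ℕ.+ suc j)
        low = ℕSolver.solve-∀
        E≡F+ : E ≡ F ℕ.+ suc j ℕ.* s
        E≡F+ = trans (cong (ℕ._* s) (top j n (triangular j)))
                     (ℕₚ.*-distribʳ-+ s (suc j ℕ.* n ℕ.+ triangular (suc j)) (suc j))
        G≡F : (j ℕ.* suc n ℕ.+ triangular j ℕ.+ suc n) ℕ.* s ≡ F
        G≡F = cong (ℕ._* s) (low j n (triangular j))
        telescope : ∀ a u v → (-1ℤ * a) * v ≡ (-1ℤ * a) * u + a * (u + -1ℤ * v)
        telescope = solve-∀

      partialSum-suc : ∀ {m} n x → m ≤ n →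
        sumUpTo (λ k → shanksTerm (suc n) k x) m ≡ sumUpTo (λ k → shanksTerm n k x) m - carry n m x
      partialSum-suc {zero}  n x _   = shanksTerm-expand n x z≤n
      partialSum-suc {suc m} n x m<n =
        trans (cong₂ _+_ (partialSum-suc n x (ℕₚ.<⇒≤ m<n)) (shanksTerm-suc n x m<n))
              (cancel (sumUpTo (λ k → shanksTerm n k x) m) (carry n m x) (shanksTerm n (suc m) x) (carry n (suc m) x))
        where
        cancel : ∀ a b c d → (a - b) + ((c + b) - d) ≡ (a + c) - d
        cancel = solve-∀

    shanksSum-suc : ∀ n x → shanksSum (suc n) x ≡
      shanksSum n x + -1ℤ ^ suc n * (shift (gpent (+ suc n) ℕ.* s) b x + shift (gpent -[1+ n ] ℕ.* s) b x)
    shanksSum-suc n x = begin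
      sumUpTo (λ k → shanksTerm (suc n) k x) n + shanksTerm (suc n) (suc n) x
        ≡⟨ cong (_+ shanksTerm (suc n) (suc n) x) (partialSum-suc n x ℕₚ.≤-refl) ⟩
      shanksSum n x - carry n n x + shanksTerm (suc n) (suc n) x
        ≡⟨ cong₂ (λ u v → shanksSum n x - -1ℤ ^ n * u + -1ℤ ^ suc n * v) carry-top new-top ⟩
      shanksSum n x - -1ℤ ^ n * U + -1ℤ ^ suc n * V
        ≡⟨ collect (shanksSum n x) (-1ℤ ^ n) U V ⟩
      shanksSum n x + -1ℤ ^ suc n * (V + U)
        ∎
      where
      open ≡-Reasoning
      U = shift (gpent -[1+ n ] ℕ.* s) b x
      V = shift (gpent (+ suc n) ℕ.* s) b x
      carry-top : shift ((n ℕ.* suc n ℕ.+ triangular n ℕ.+ suc n) ℕ.* s) (poch n n b) x ≡ U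
      carry-top rewrite poch-empty {n} b ℕₚ.≤-refl | pentagonal-suc-as-triangular n = refl
      new-top : shift ((suc n ℕ.* suc n ℕ.+ triangular (suc n)) ℕ.* s) (poch (suc n) (suc n) b) x ≡ V
      new-top rewrite poch-empty {suc n} b ℕₚ.≤-refl | pentagonal+id≡square+triangular (suc n) = refl
      collect : ∀ a c u v → a - c * u + (-1ℤ * c) * v ≡ a + (-1ℤ * c) * (v + u)
      collect = solve-∀

    -- Shanks: Σ_{k=0}^{n} (−1)ᵏ q^{s(kn + k(k+1)/2)} ∏_{i=k+1}^{n} (1 − q^{is}) = Σ_{|k|≤n} (−1)ᵏ q^{s k(3k+1)/2}.
    shanks : ∀ n x → shanksSum n x ≡ pentagonalSum n x
    shanks zero    x = ℤₚ.*-identityˡ (b x)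
    shanks (suc n) x = trans (shanksSum-suc n x) (cong (λ v → v + -1ℤ ^ suc n * new) (shanks n x))
      where new = shift (gpent (+ suc n) ℕ.* s) b x + shift (gpent -[1+ n ] ℕ.* s) b x

    pentagonalSum-lowDegree : ∀ n {x} → x < suc n ℕ.* s → pentagonalSum n x ≡ poch 0 n b x
    pentagonalSum-lowDegree n {x} x<ns = begin
      pentagonalSum n x  ≡⟨ shanks n x ⟨
      shanksSum n x      ≡⟨ onlyFirst n ⟩
      shanksTerm n 0 x   ≡⟨ ℤₚ.*-identityˡ (poch 0 n b x) ⟩
      poch 0 n b x       ∎
      where
      open ≡-Reasoning
      vanish : ∀ m → shanksTerm n (suc m) x ≡ 0ℤ
      vanish m = trans (cong (-1ℤ ^ suc m *_) (shift-below _ (poch (suc m) n b) x<bound)) (ℤₚ.*-zeroʳ (-1ℤ ^ suc m))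
        where
        bound : suc n ≤ suc m ℕ.* n ℕ.+ triangular (suc m)
        bound = subst (_≤ suc m ℕ.* n ℕ.+ triangular (suc m)) (ℕₚ.+-comm n 1)
          (ℕₚ.+-mono-≤ (ℕₚ.m≤m+n n (m ℕ.* n)) (ℕₚ.≤-trans (s≤s z≤n) (ℕₚ.m≤n+m (suc m) (triangular m))))
        x<bound : x < (suc m ℕ.* n ℕ.+ triangular (suc m)) ℕ.* s
        x<bound = ℕₚ.<-≤-trans x<ns (ℕₚ.*-monoˡ-≤ s bound)
      onlyFirst : ∀ m → sumUpTo (λ k → shanksTerm n k x) m ≡ shanksTerm n 0 x
      onlyFirst zero    = refl
      onlyFirst (suc m) = trans (cong₂ _+_ (onlyFirst m) (vanish m)) (ℤₚ.+-identityʳ (shanksTerm n 0 x))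

module S₁ = Shanks 1
module S₂ = Shanks 2

filter-map : ∀ {A B : Set} {P : B → Set} (P? : Decidable P) (f : A → B) xs →
             filter P? (map f xs) ≡ map f (filter (P? ∘ f) xs)
filter-map P? f []       = refl
filter-map P? f (x ∷ xs) with does (P? (f x))
... | true  = cong (f x ∷_) (filter-map P? f xs)
... | false = filter-map P? f xs

count : ℕ → List (List ℕ) → ℕ
count x = length ∘ filter (λ xs → sum xs ℕ.≟ x)

count-++ : ∀ x L M → count x (L ++ M) ≡ count x L ℕ.+ count x M
count-++ x L M =
  trans (cong length (filter-++ (λ xs → sum xs ℕ.≟ x) L M)) (length-++ (filter (λ xs → sum xs ℕ.≟ x) L))

count-map-∷ : ∀ a L x → count x (map (a ∷_) L) ≡ length (filter (λ xs → a ℕ.+ sum xs ℕ.≟ x) L)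
count-map-∷ a L x = trans (cong length (filter-map (λ xs → sum xs ℕ.≟ x) (a ∷_) L))
                          (length-map (a ∷_) (filter (λ xs → a ℕ.+ sum xs ℕ.≟ x) L))

count-map-∷-shift : ∀ a L x → + count x (map (a ∷_) L) ≡ shift a (λ y → + count y L) x
count-map-∷-shift a L x with ℕₚ.≤-<-connex a x
... | inj₁ a≤x = begin
  + count x (map (a ∷_) L)
    ≡⟨ cong +_ (count-map-∷ a L x) ⟩
  + length (filter (λ xs → a ℕ.+ sum xs ℕ.≟ x) L)
    ≡⟨ cong (λ z → + length (filter (λ xs → a ℕ.+ sum xs ℕ.≟ z) L)) x≡a+y ⟩
  + length (filter (λ xs → a ℕ.+ sum xs ℕ.≟ a ℕ.+ y) L)
    ≡⟨ cong (λ l → + length l) (filter-≐ _ _ (ℕₚ.+-cancelˡ-≡ a _ _ , cong (a ℕ.+_)) L) ⟩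
  + count y L
    ≡⟨ shift-+ a (λ y → + count y L) y ⟨
  shift a (λ y → + count y L) (a ℕ.+ y)
    ≡⟨ cong (shift a (λ y → + count y L)) x≡a+y ⟨
  shift a (λ y → + count y L) x ∎
  where
  open ≡-Reasoning
  y = x ℕ.∸ a
  x≡a+y : x ≡ a ℕ.+ y
  x≡a+y = sym (ℕₚ.m+[n∸m]≡n a≤x)
... | inj₂ x<a = begin
  + count x (map (a ∷_) L)
    ≡⟨ cong +_ (count-map-∷ a L x) ⟩
  + length (filter (λ xs → a ℕ.+ sum xs ℕ.≟ x) L)
    ≡⟨ cong (λ l → + length l) (filter-none _ (All.universal tooBig L)) ⟩
  0ℤ
    ≡⟨ shift-below a _ x<a ⟨
  shift a (λ y → + count y L) x ∎
  where
  open ≡-Reasoning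
  tooBig : ∀ xs → a ℕ.+ sum xs ≢ x
  tooBig xs eq = ℕₚ.<⇒≱ x<a (subst (a ≤_) eq (ℕₚ.m≤m+n a (sum xs)))

-- multiplication by ∏_{i < j} (1 + q^{2i+1})
oddParts : ℕ → Series → Series
oddParts zero    f = f
oddParts (suc j) f = factor 1ℤ (2 ℕ.* j ℕ.+ 1) (oddParts j f)

oddParts-cong : ∀ j {f g} → f ≈ g → oddParts j f ≈ oddParts j g
oddParts-cong zero    f≈g = f≈g
oddParts-cong (suc j) f≈g = factor-cong 1ℤ (2 ℕ.* j ℕ.+ 1) (oddParts-cong j f≈g)

count-oddSubsets : ∀ j x → + count x (oddSubsets j) ≡ oddParts j one x
count-oddSubsets zero    zero    = refl
count-oddSubsets zero    (suc x) = refl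
count-oddSubsets (suc j) x = begin
  + count x (oddSubsets j ++ map (a ∷_) (oddSubsets j))
    ≡⟨ cong +_ (count-++ x (oddSubsets j) (map (a ∷_) (oddSubsets j))) ⟩
  + count x (oddSubsets j) + + count x (map (a ∷_) (oddSubsets j))
    ≡⟨ cong₂ _+_ (count-oddSubsets j x) (count-map-∷-shift a (oddSubsets j) x) ⟩
  oddParts j one x + shift a (λ y → + count y (oddSubsets j)) x
    ≡⟨ cong (λ v → oddParts j one x + v) (shift-cong a (count-oddSubsets j) x) ⟩
  oddParts j one x + shift a (oddParts j one) x
    ≡⟨ cong (λ v → oddParts j one x + v) (ℤₚ.*-identityˡ _) ⟨
  oddParts j one x + 1ℤ * shift a (oddParts j one) x
    ∎
  where
  open ≡-Reasoning
  a = 2 ℕ.* j ℕ.+ 1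

oddParts-stable : ∀ {j n} f {x} → j ≤ n → x ≤ 2 ℕ.* j → oddParts n f x ≡ oddParts j f x
oddParts-stable {j} {zero}  f z≤n      x≤2j = refl
oddParts-stable {j} {suc n} f {x} j≤1+n x≤2j with ℕₚ.m≤n⇒m<n∨m≡n j≤1+n
... | inj₂ refl      = refl
... | inj₁ (s≤s j≤n) =
  trans (factor-below 1ℤ (2 ℕ.* n ℕ.+ 1) (oddParts n f) x<2n+1) (oddParts-stable f j≤n x≤2j)
  where
  x<2n+1 : x < 2 ℕ.* n ℕ.+ 1
  x<2n+1 = subst (x <_) (ℕₚ.+-comm 1 (2 ℕ.* n)) (s≤s (ℕₚ.≤-trans x≤2j (ℕₚ.*-monoʳ-≤ 2 j≤n)))

pdo≡oddParts : ∀ {n x} → x ≤ n → + pdo x ≡ oddParts n one x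
pdo≡oddParts {n} {x} x≤n = trans (count-oddSubsets x x) (sym (oddParts-stable one x≤n (ℕₚ.m≤n*m x 2)))

euler : ℕ → Series
euler = S₁.pentagonalSum one

euler-suc : ∀ j x → euler (suc j) x ≡
  euler j x + -1ℤ ^ suc j * (shift (gpent (+ suc j)) one x + shift (gpent -[1+ j ]) one x)
euler-suc j x = cong₂ (λ u v → euler j x + -1ℤ ^ suc j * (shift u one x + shift v one x))
                      (ℕₚ.*-identityʳ (gpent (+ suc j))) (ℕₚ.*-identityʳ (gpent -[1+ j ]))

euler-unchanged : ∀ j {x} → x ≢ gpent (+ suc j) → x ≢ gpent -[1+ j ] → euler (suc j) x ≡ euler j x
euler-unchanged j {x} x≢new⁺ x≢new⁻ = begin
  euler (suc j) x
    ≡⟨ euler-suc j x ⟩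
  euler j x + -1ℤ ^ suc j * (shift (gpent (+ suc j)) one x + shift (gpent -[1+ j ]) one x)
    ≡⟨ cong₂ (λ u v → euler j x + -1ℤ ^ suc j * (u + v)) (shift-one-≢ _ x≢new⁺) (shift-one-≢ _ x≢new⁻) ⟩
  euler j x + -1ℤ ^ suc j * 0ℤ
    ≡⟨ cong (λ v → euler j x + v) (ℤₚ.*-zeroʳ (-1ℤ ^ suc j)) ⟩
  euler j x + 0ℤ
    ≡⟨ ℤₚ.+-identityʳ (euler j x) ⟩
  euler j x
    ∎
  where open ≡-Reasoning

euler-above : ∀ j {x} → gpent (+ j) < x → euler j x ≡ 0ℤ
euler-above zero    {suc x} _      = refl
euler-above (suc j) {x}     new<x  =
  trans (euler-unchanged j (ℕₚ.>⇒≢ new<x) (ℕₚ.>⇒≢ new⁻<x))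
        (euler-above j (ℕₚ.<-trans (gpent-pos<pentagonal-suc j) new⁻<x))
  where
  new⁻<x : pentagonal (suc j) < x
  new⁻<x = ℕₚ.≤-<-trans (ℕₚ.m≤m+n (pentagonal (suc j)) (suc j)) new<x

euler-stable : ∀ {j n x} → x < pentagonal (suc j) → j ≤ n → euler n x ≡ euler j x
euler-stable {j} {zero}  x<p z≤n = refl
euler-stable {j} {suc n} {x} x<p j≤1+n with ℕₚ.m≤n⇒m<n∨m≡n j≤1+n
... | inj₂ refl      = refl
... | inj₁ (s≤s j≤n) =
  trans (euler-unchanged n (ℕₚ.<⇒≢ (ℕₚ.<-≤-trans x<new⁻ (ℕₚ.m≤m+n _ (suc n)))) (ℕₚ.<⇒≢ x<new⁻))
        (euler-stable x<p j≤n)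
  where
  x<new⁻ : x < pentagonal (suc n)
  x<new⁻ = ℕₚ.<-≤-trans x<p (pentagonal-mono-≤ (s≤s j≤n))

euler-off : ∀ j {x} → (∀ k → x ≢ gpent k) → euler j x ≡ 0ℤ
euler-off zero    {zero}  off = ⊥-elim (off (+ 0) refl)
euler-off zero    {suc x} off = refl
euler-off (suc j)         off = trans (euler-unchanged j (off (+ suc j)) (off -[1+ j ])) (euler-off j off)

euler-gpent : ∀ k {n} → ∣ k ∣ ≤ n → euler n (gpent k) ≡ -1ℤ ^ ∣ k ∣
euler-gpent (+ zero)  k≤n = euler-stable (s≤s z≤n) k≤n
euler-gpent (+ suc a) {n} k≤n = begin
  euler n x
    ≡⟨ euler-stable (gpent-pos<pentagonal-suc (suc a)) k≤n ⟩
  euler (suc a) x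
    ≡⟨ euler-suc a x ⟩
  euler a x + -1ℤ ^ suc a * (shift x one x + shift (pentagonal (suc a)) one x)
    ≡⟨ cong₂ (λ v w → euler a x + -1ℤ ^ suc a * (v + w)) (shift-one-≡ x) (shift-one-≢ _ (ℕₚ.>⇒≢ other<x)) ⟩
  euler a x + -1ℤ ^ suc a * (1ℤ + 0ℤ)
    ≡⟨ cong (λ u → u + -1ℤ ^ suc a * 1ℤ) (euler-above a older<x) ⟩
  0ℤ + -1ℤ ^ suc a * (1ℤ + 0ℤ)
    ≡⟨ simplify (-1ℤ ^ suc a) ⟩
  -1ℤ ^ suc a ∎
  where
  open ≡-Reasoning
  x = gpent (+ suc a)
  other<x : pentagonal (suc a) < x
  other<x = ℕₚ.m<m+n (pentagonal (suc a)) (s≤s z≤n)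
  older<x : gpent (+ a) < x
  older<x = ℕₚ.<-trans (gpent-pos<pentagonal-suc a) other<x
  simplify : ∀ c → 0ℤ + c * (1ℤ + 0ℤ) ≡ c
  simplify = solve-∀
euler-gpent -[1+ a ]  {n} k≤n = begin
  euler n x
    ≡⟨ euler-stable (pentagonal<pentagonal-suc (suc a)) k≤n ⟩
  euler (suc a) x
    ≡⟨ euler-suc a x ⟩
  euler a x + -1ℤ ^ suc a * (shift (gpent (+ suc a)) one x + shift x one x)
    ≡⟨ cong₂ (λ v w → euler a x + -1ℤ ^ suc a * (v + w)) (shift-one-≢ _ (ℕₚ.<⇒≢ x<other)) (shift-one-≡ x) ⟩
  euler a x + -1ℤ ^ suc a * (0ℤ + 1ℤ)
    ≡⟨ cong (λ u → u + -1ℤ ^ suc a * 1ℤ) (euler-above a (gpent-pos<pentagonal-suc a)) ⟩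
  0ℤ + -1ℤ ^ suc a * (0ℤ + 1ℤ)
    ≡⟨ simplify (-1ℤ ^ suc a) ⟩
  -1ℤ ^ suc a ∎
  where
  open ≡-Reasoning
  x = gpent -[1+ a ]
  x<other : x < gpent (+ suc a)
  x<other = ℕₚ.m<m+n (pentagonal (suc a)) (s≤s z≤n)
  simplify : ∀ c → 0ℤ + c * (0ℤ + 1ℤ) ≡ c
  simplify = solve-∀

pdoℤ-neg : ∀ {d} → 0 < d → pdoℤ (- + d) ≡ 0
pdoℤ-neg {suc d} _ = refl

pdoℤ-shift : ∀ n e → + pdoℤ (+ n - + e) ≡ shift e (oddParts n one) n
pdoℤ-shift n e with ℕₚ.≤-<-connex e n
... | inj₁ e≤n = begin
  + pdoℤ (+ n - + e)
    ≡⟨ cong (λ z → + pdoℤ z) (trans (ℤₚ.m-n≡m⊖n n e) (ℤₚ.⊖-≥ e≤n)) ⟩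
  + pdo (n ℕ.∸ e)
    ≡⟨ pdo≡oddParts (ℕₚ.m∸n≤m n e) ⟩
  oddParts n one (n ℕ.∸ e)
    ≡⟨ shift-+ e (oddParts n one) (n ℕ.∸ e) ⟨
  shift e (oddParts n one) (e ℕ.+ (n ℕ.∸ e))
    ≡⟨ cong (shift e (oddParts n one)) (ℕₚ.m+[n∸m]≡n e≤n) ⟩
  shift e (oddParts n one) n ∎
  where open ≡-Reasoning
... | inj₂ n<e = begin
  + pdoℤ (+ n - + e)
    ≡⟨ cong (λ z → + pdoℤ z) (trans (ℤₚ.m-n≡m⊖n n e) (ℤₚ.⊖-< n<e)) ⟩
  + pdoℤ (- + (e ℕ.∸ n))
    ≡⟨ cong +_ (pdoℤ-neg (ℕₚ.m<n⇒0<n∸m n<e)) ⟩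
  0ℤ
    ≡⟨ shift-below e (oddParts n one) n<e ⟨
  shift e (oddParts n one) n ∎
  where open ≡-Reasoning

-1^pentagonal≡-1^⌊1+a/2⌋ : ∀ a → -1ℤ ^ pentagonal a ≡ -1ℤ ^ ⌊ suc a /2⌋
-1^pentagonal≡-1^⌊1+a/2⌋ zero          = refl
-1^pentagonal≡-1^⌊1+a/2⌋ (suc zero)    = refl
-1^pentagonal≡-1^⌊1+a/2⌋ (suc (suc a)) = begin
  -1ℤ ^ pentagonal (suc (suc a))
    ≡⟨ cong (-1ℤ ^_) (regroup (pentagonal a) a) ⟩
  -1ℤ * -1ℤ ^ (pentagonal a ℕ.+ (3 ℕ.* a ℕ.+ 2) ℕ.* 2)
    ≡⟨ cong (-1ℤ *_) (-1^[p+k*2]≡-1^p (pentagonal a) (3 ℕ.* a ℕ.+ 2)) ⟩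
  -1ℤ * -1ℤ ^ pentagonal a
    ≡⟨ cong (-1ℤ *_) (-1^pentagonal≡-1^⌊1+a/2⌋ a) ⟩
  -1ℤ * -1ℤ ^ ⌊ suc a /2⌋ ∎
  where
  open ≡-Reasoning
  regroup : ∀ p a → p ℕ.+ (3 ℕ.* a ℕ.+ 1) ℕ.+ (3 ℕ.* suc a ℕ.+ 1) ≡ suc (p ℕ.+ (3 ℕ.* a ℕ.+ 2) ℕ.* 2)
  regroup = ℕSolver.solve-∀

gpent-sign : ∀ k → -1ℤ ^ gpent k * -1ℤ ^ ∣ k ∣ ≡ signPow (ceilHalf k)
gpent-sign (+ a) = begin
  -1ℤ ^ (pentagonal a ℕ.+ a) * -1ℤ ^ a   ≡⟨ ℤₚ.^-distribˡ-+-* -1ℤ (pentagonal a ℕ.+ a) a ⟨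
  -1ℤ ^ (pentagonal a ℕ.+ a ℕ.+ a)       ≡⟨ cong (-1ℤ ^_) (regroup (pentagonal a) a) ⟩
  -1ℤ ^ (pentagonal a ℕ.+ a ℕ.* 2)       ≡⟨ -1^[p+k*2]≡-1^p (pentagonal a) a ⟩
  -1ℤ ^ pentagonal a                     ≡⟨ -1^pentagonal≡-1^⌊1+a/2⌋ a ⟩
  -1ℤ ^ ⌊ suc a /2⌋                      ≡⟨ signPow-pos ⌊ suc a /2⌋ ⟨
  signPow (+ ⌊ suc a /2⌋)                ∎
  where
  open ≡-Reasoning
  regroup : ∀ p a → p ℕ.+ a ℕ.+ a ≡ p ℕ.+ a ℕ.* 2
  regroup = ℕSolver.solve-∀
gpent-sign -[1+ a ] = begin
  -1ℤ ^ pentagonal (suc a) * -1ℤ ^ suc a        ≡⟨ ℤₚ.^-distribˡ-+-* -1ℤ (pentagonal (suc a)) (suc a) ⟨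
  -1ℤ ^ (pentagonal (suc a) ℕ.+ suc a)          ≡⟨ cong (-1ℤ ^_) (regroup (pentagonal a) a) ⟩
  -1ℤ ^ (pentagonal a ℕ.+ (2 ℕ.* a ℕ.+ 1) ℕ.* 2) ≡⟨ -1^[p+k*2]≡-1^p (pentagonal a) (2 ℕ.* a ℕ.+ 1) ⟩
  -1ℤ ^ pentagonal a                            ≡⟨ -1^pentagonal≡-1^⌊1+a/2⌋ a ⟩
  -1ℤ ^ ⌊ suc a /2⌋                             ≡⟨ cong (-1ℤ ^_) (ℤₚ.∣-i∣≡∣i∣ (+ ⌊ suc a /2⌋)) ⟨
  -1ℤ ^ ∣ - + ⌊ suc a /2⌋ ∣                     ≡⟨ signPow≡-1^∣z∣ (- + ⌊ suc a /2⌋) ⟨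
  signPow (- + ⌊ suc a /2⌋)                     ∎
  where
  open ≡-Reasoning
  regroup : ∀ p a → p ℕ.+ (3 ℕ.* a ℕ.+ 1) ℕ.+ suc a ≡ p ℕ.+ (2 ℕ.* a ℕ.+ 1) ℕ.* 2
  regroup = ℕSolver.solve-∀

k[3k+1]≡gpent*2 : ∀ k → k * (+ 3 * k + 1ℤ) ≡ + (gpent k ℕ.* 2)
k[3k+1]≡gpent*2 (+ a) = begin
  + a * (+ 3 * + a + 1ℤ)      ≡⟨ cong (λ z → + a * (z + 1ℤ)) (ℤₚ.pos-* 3 a) ⟨
  + a * + (3 ℕ.* a ℕ.+ 1)     ≡⟨ ℤₚ.pos-* a (3 ℕ.* a ℕ.+ 1) ⟨
  + (a ℕ.* (3 ℕ.* a ℕ.+ 1))   ≡⟨ cong +_ (gpent-pos-double a) ⟩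
  + (gpent (+ a) ℕ.* 2)       ∎
  where open ≡-Reasoning
k[3k+1]≡gpent*2 -[1+ a ] = begin
  - X * (+ 3 * - X + 1ℤ)           ≡⟨ negate X ⟩
  X * (+ 3 * X - 1ℤ)               ≡⟨ cong (λ z → X * (z - 1ℤ)) (ℤₚ.pos-* 3 (suc a)) ⟨
  X * (+ (3 ℕ.* suc a) - 1ℤ)       ≡⟨ cong (λ m → X * (+ m - 1ℤ)) (three a) ⟩
  X * + (3 ℕ.* a ℕ.+ 2)            ≡⟨ ℤₚ.pos-* (suc a) (3 ℕ.* a ℕ.+ 2) ⟨
  + (suc a ℕ.* (3 ℕ.* a ℕ.+ 2))    ≡⟨ cong +_ (gpent-neg-double a) ⟩
  + (gpent -[1+ a ] ℕ.* 2)         ∎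
  where
  open ≡-Reasoning
  X = + suc a
  negate : ∀ x → - x * (+ 3 * - x + 1ℤ) ≡ x * (+ 3 * x - 1ℤ)
  negate = solve-∀
  three : ∀ a → 3 ℕ.* suc a ≡ suc (3 ℕ.* a ℕ.+ 2)
  three = ℕSolver.solve-∀

2n≡k[3k+1]⇔n≡gpent : ∀ n k → (+ 2 * + n ≡ k * (+ 3 * k + 1ℤ)) ⇔ (n ≡ gpent k)
2n≡k[3k+1]⇔n≡gpent n k = mk⇔
  (λ eq → ℕₚ.*-cancelʳ-≡ n (gpent k) 2
            (ℤₚ.+-injective (trans (sym (twice n)) (trans eq (k[3k+1]≡gpent*2 k)))))
  (λ { refl → trans (twice (gpent k)) (sym (k[3k+1]≡gpent*2 k)) })
  where
  twice : ∀ n → + 2 * + n ≡ + (n ℕ.* 2)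
  twice n = trans (sym (ℤₚ.pos-* 2 n)) (cong +_ (ℕₚ.*-comm 2 n))

term-as-coefficient : ∀ n k → term n k ≡ -1ℤ ^ ∣ k ∣ * shift (gpent k ℕ.* 2) (oddParts n one) n
term-as-coefficient n k = cong₂ _*_ (signPow≡-1^∣z∣ k)
  (trans (cong (λ z → + pdoℤ (+ n - z)) (k[3k+1]≡gpent*2 k)) (pdoℤ-shift n (gpent k ℕ.* 2)))

symSum-term : ∀ n N → symSum (term n) N ≡ S₂.pentagonalSum (oddParts n one) N n
symSum-term n zero    = trans (term-as-coefficient n 0ℤ) (ℤₚ.*-identityˡ (oddParts n one n))
symSum-term n (suc N) = begin
  symSum (term n) N + term n (+ suc N) + term n -[1+ N ]
    ≡⟨ cong₂ (λ u v → u + v + term n -[1+ N ]) (symSum-term n N) (term-as-coefficient n (+ suc N)) ⟩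
  S + -1ℤ ^ suc N * U + term n -[1+ N ]
    ≡⟨ cong (λ v → S + -1ℤ ^ suc N * U + v) (term-as-coefficient n -[1+ N ]) ⟩
  S + -1ℤ ^ suc N * U + -1ℤ ^ suc N * V
    ≡⟨ collect S (-1ℤ ^ suc N) U V ⟩
  S + -1ℤ ^ suc N * (U + V)
    ∎
  where
  open ≡-Reasoning
  S = S₂.pentagonalSum (oddParts n one) N n
  U = shift (gpent (+ suc N) ℕ.* 2) (oddParts n one) n
  V = shift (gpent -[1+ N ] ℕ.* 2) (oddParts n one) n
  collect : ∀ s c u v → s + c * u + c * v ≡ s + c * (u + v)
  collect = solve-∀

twist-one : one ≈ twist one
twist-one zero    = refl
twist-one (suc x) = sym (ℤₚ.*-zeroʳ (-1ℤ ^ suc x))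

-- (q²; q²)_j (−q; q²)_j = (−q; −q)_{2j}
oddParts-twist : ∀ j f → S₂.poch 0 j (oddParts j (twist f)) ≈ twist (S₁.poch 0 (j ℕ.* 2) f)
oddParts-twist zero    f x = refl
oddParts-twist (suc j) f x = begin
  S₂.poch 0 (suc j) (factor 1ℤ odd (oddParts j (twist f))) x
    ≡⟨ cong (λ h → h x) (S₂.poch-suc j (factor 1ℤ odd (oddParts j (twist f))) z≤n) ⟩
  factor -1ℤ even (S₂.poch 0 j (factor 1ℤ odd (oddParts j (twist f)))) x
    ≡⟨ factor-cong -1ℤ even (S₂.factor-poch 1ℤ odd 0 j (oddParts j (twist f))) x ⟨
  factor -1ℤ even (factor 1ℤ odd (S₂.poch 0 j (oddParts j (twist f)))) x
    ≡⟨ factor-cong -1ℤ even (factor-cong 1ℤ odd (oddParts-twist j f)) x ⟩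
  factor -1ℤ even (factor 1ℤ odd (twist P)) x
    ≡⟨ factor-cong -1ℤ even (factor-twist odd P odd-sign) x ⟩
  factor -1ℤ even (twist (factor -1ℤ odd P)) x
    ≡⟨ factor-twist even (factor -1ℤ odd P) even-sign x ⟩
  twist (factor -1ℤ even (factor -1ℤ odd P)) x
    ≡⟨ cong (-1ℤ ^ x *_) unfold ⟩
  twist (S₁.poch 0 (suc j ℕ.* 2) f) x
    ∎
  where
  open ≡-Reasoning
  odd  = 2 ℕ.* j ℕ.+ 1
  even = suc j ℕ.* 2
  P    = S₁.poch 0 (j ℕ.* 2) f
  odd≡ : odd ≡ suc (j ℕ.* 2)
  odd≡ = trans (ℕₚ.+-comm (2 ℕ.* j) 1) (cong suc (ℕₚ.*-comm 2 j))
  odd-sign : -1ℤ ≡ -1ℤ ^ odd * 1ℤ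
  odd-sign = sym (begin
    -1ℤ ^ odd * 1ℤ           ≡⟨ ℤₚ.*-identityʳ (-1ℤ ^ odd) ⟩
    -1ℤ ^ odd                ≡⟨ cong (-1ℤ ^_) odd≡ ⟩
    -1ℤ * -1ℤ ^ (j ℕ.* 2)    ≡⟨ cong (-1ℤ *_) (-1^[k*2]≡1 j) ⟩
    -1ℤ                      ∎)
  even-sign : -1ℤ ≡ -1ℤ ^ even * -1ℤ
  even-sign = sym (cong (_* -1ℤ) (-1^[k*2]≡1 (suc j)))
  unfold : factor -1ℤ even (factor -1ℤ odd P) x ≡ S₁.poch 0 (suc j ℕ.* 2) f x
  unfold = sym (begin
    S₁.poch 0 (suc (suc (j ℕ.* 2))) f x
      ≡⟨ cong (λ h → h x) (S₁.poch-suc (suc (j ℕ.* 2)) f z≤n) ⟩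
    factor -1ℤ (suc (suc (j ℕ.* 2)) ℕ.* 1) (S₁.poch 0 (suc (j ℕ.* 2)) f) x
      ≡⟨ cong (λ h → factor -1ℤ (suc (suc (j ℕ.* 2)) ℕ.* 1) h x) (S₁.poch-suc (j ℕ.* 2) f z≤n) ⟩
    factor -1ℤ (suc (suc (j ℕ.* 2)) ℕ.* 1) (factor -1ℤ (suc (j ℕ.* 2) ℕ.* 1) P) x
      ≡⟨ factor-cong -1ℤ (suc (suc (j ℕ.* 2)) ℕ.* 1) (factor-≡ -1ℤ P (trans (ℕₚ.*-identityʳ _) (sym odd≡))) x ⟩
    factor -1ℤ (suc (suc (j ℕ.* 2)) ℕ.* 1) (factor -1ℤ odd P) x
      ≡⟨ factor-≡ -1ℤ (factor -1ℤ odd P) (ℕₚ.*-identityʳ even) x ⟩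
    factor -1ℤ even (factor -1ℤ odd P) x
      ∎)

symSum-term≡euler : ∀ {n N} → n ≤ N → symSum (term n) N ≡ -1ℤ ^ n * euler n n
symSum-term≡euler {n} {N} n≤N = begin
  symSum (term n) N
    ≡⟨ symSum-term n N ⟩
  S₂.pentagonalSum g N n
    ≡⟨ S₂.pentagonalSum-lowDegree g N (below 2 n≤N) ⟩
  S₂.poch 0 N g n
    ≡⟨ S₂.poch-stable g n≤N (below 2 ℕₚ.≤-refl) ⟩
  S₂.poch 0 n g n
    ≡⟨ S₂.poch-cong 0 n (oddParts-cong n twist-one) n ⟩
  S₂.poch 0 n (oddParts n (twist one)) n
    ≡⟨ oddParts-twist n one n ⟩
  -1ℤ ^ n * S₁.poch 0 (n ℕ.* 2) one n
    ≡⟨ cong (-1ℤ ^ n *_) (S₁.poch-stable one (ℕₚ.m≤m*n n 2) (below 1 ℕₚ.≤-refl)) ⟩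
  -1ℤ ^ n * S₁.poch 0 n one n
    ≡⟨ cong (-1ℤ ^ n *_) (S₁.pentagonalSum-lowDegree one n (below 1 ℕₚ.≤-refl)) ⟨
  -1ℤ ^ n * euler n n ∎
  where
  open ≡-Reasoning
  g = oddParts n one
  below : ∀ s .{{_ : ℕ.NonZero s}} {m} → n ≤ m → n < suc m ℕ.* s
  below s {m} n≤m = ℕₚ.<-≤-trans (s≤s n≤m) (ℕₚ.m≤m*n (suc m) s)

corollary3p12 : (n : ℕ) →
    Σ ℕ (λ N₀ → (N : ℕ) → N₀ ≤ N →
    ((m : ℤ) → + 2 * + n ≡ m * (+ 3 * m + 1ℤ) → symSum (term n) N ≡ signPow (ceilHalf m))
    × (((m : ℤ) → ¬ (+ 2 * + n ≡ m * (+ 3 * m + 1ℤ))) → symSum (term n) N ≡ 0ℤ))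
corollary3p12 n = n , λ N n≤N → pentagonalCase N n≤N , otherCase N n≤N
  where
  open ≡-Reasoning
  pent : ∀ k → (+ 2 * + n ≡ k * (+ 3 * k + 1ℤ)) ⇔ (n ≡ gpent k)
  pent = 2n≡k[3k+1]⇔n≡gpent n
  pentagonalCase : ∀ N → n ≤ N → (m : ℤ) → + 2 * + n ≡ m * (+ 3 * m + 1ℤ) →
                   symSum (term n) N ≡ signPow (ceilHalf m)
  pentagonalCase N n≤N m 2n≡ with refl ← Equivalence.to (pent m) 2n≡ = begin
    symSum (term (gpent m)) N                  ≡⟨ symSum-term≡euler n≤N ⟩
    -1ℤ ^ gpent m * euler (gpent m) (gpent m)  ≡⟨ cong (-1ℤ ^ gpent m *_) (euler-gpent m (∣k∣≤gpent m)) ⟩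
    -1ℤ ^ gpent m * -1ℤ ^ ∣ m ∣                ≡⟨ gpent-sign m ⟩
    signPow (ceilHalf m)                       ∎
  otherCase : ∀ N → n ≤ N → ((m : ℤ) → ¬ (+ 2 * + n ≡ m * (+ 3 * m + 1ℤ))) → symSum (term n) N ≡ 0ℤ
  otherCase N n≤N notPentagonal = begin
    symSum (term n) N    ≡⟨ symSum-term≡euler n≤N ⟩
    -1ℤ ^ n * euler n n  ≡⟨ cong (-1ℤ ^ n *_) (euler-off n (λ k → notPentagonal k ∘ Equivalence.from (pent k))) ⟩
    -1ℤ ^ n * 0ℤ         ≡⟨ ℤₚ.*-zeroʳ (-1ℤ ^ n) ⟩
    0ℤ                   ∎
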